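{- Let $n\ge1$, let $\pi=\ddot\psi\backslash A$ with $A\in\{\mathtt q,\mathtt s\}^n$, and let $k\in\{0,\dots,n-1\}$. Then $f_\pi(0\backslash k,daaaadda)=3\backslash k$, and for every state $k'\ge 1\backslash k$ one has $f_\pi(k',daaaadda)\ge 5\backslash k$.
   Context: For $\psi\in\{\mathtt q,\mathtt s\}^N$ indexed from $0$, $\Pi(\psi)$ is the DFA over $\{a,d\}$ with states $\{0,\dots,N\}$, start $0$, accepting $\{0,\dots,N-1\}$, transition from $k<N$ on $c$ to $k+[\psi(k)=\mathtt q,c=d]+[\psi(k)=\mathtt s,c=a]$, state $N$ absorbing; $f_\pi(k,W)$ is the state reached from $k$ after reading $W$. Let $\ddot\psi=\mathtt{qqqqss}$; for $A=x_0\cdots x_{L-1}\in\{\mathtt q,\mathtt s\}^L$, $\ddot\psi\backslash A$ is the chain $\Pi(B_0\cdots B_{L-1})$ with $B_k=\mathtt{qqqqss}$ if $x_k=\mathtt q$, $B_k=\mathtt{qqssss}$ if $x_k=\mathtt s$. For $0\le b\le 5$, $b\backslash k$ denotes the state $b+6k$. -}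

module Defs where

open import Data.Nat using (ℕ; zero; suc; _+_; _*_)
open import Data.List using (List; []; _∷_; _++_; concatMap; length)

data QS : Set where
  q s : QS

data Σad : Set where
  a d : Σad

data Maybe′ (A : Set) : Set where
  none : Maybe′ A
  some : A → Maybe′ A

at : List QS → ℕ → Maybe′ QS
at []       _       = none
at (x ∷ _)  zero    = some x
at (_ ∷ xs) (suc k) = at xs k

inc : QS → Σad → ℕ
inc q d = 1
inc q a = 0
inc s a = 1
inc s d = 0

-- transition of Π(ψ): states 0..N with N = length ψ; state N absorbing
-- (for k ≥ N there is no letter ψ(k), so the state is unchanged)
δ : List QS → ℕ → Σad → ℕ
δ ψ k c with at ψ k
... | none   = k
... | some x = k + inc x c

f : List QS → ℕ → List Σad → ℕ
f ψ k []      = k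
f ψ k (c ∷ W) = f ψ (δ ψ k c) W

block : QS → List QS
block q = q ∷ q ∷ q ∷ q ∷ s ∷ s ∷ []
block s = q ∷ q ∷ s ∷ s ∷ s ∷ s ∷ []

ψ̈\\ : List QS → List QS
ψ̈\\ A = concatMap block A

_\\_ : ℕ → ℕ → ℕ
b \\ k = b + 6 * k

daaaadda : List Σad
daaaadda = d ∷ a ∷ a ∷ a ∷ a ∷ d ∷ d ∷ a ∷ []

{-# OPTIONS --safe #-}
-- Prepending a block of length 6 to a chain shifts every run by 6, so reading a word
-- from b \\ k in ψ̈ \\ A is reading it from b in the chain of the suffix of A starting at
-- block k, shifted by 6k.  This reduces the theorem to k = 0, where it is a computation
-- inside the first block.  The bound for k′ ≥ 1 \\ k then follows because δ, hence f,
-- is monotone in the state (δ ψ m c lies between m and m + 1).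
module Submission where

open import Defs
open import Data.Nat using (ℕ; zero; suc; _+_; _≤_; _<_; _*_; z≤n)
open import Data.Nat.Properties
  using (≤-refl; ≤-trans; ≤-reflexive; n≤1+n; m≤m+n; +-comm; +-identityʳ; +-monoˡ-≤;
         +-monoʳ-≤; m≤n⇒m<n∨m≡n; m<n⇒0<n∸m; module ≤-Reasoning)
open import Data.Nat.Tactic.RingSolver using (solve-∀)
open import Data.Product using (_×_; _,_)
open import Data.Sum using (inj₁; inj₂)
open import Data.List using (List; []; _∷_; _++_; length; drop)
open import Data.List.Properties using (length-drop)
open import Relation.Binary.PropositionalEquality
  using (_≡_; refl; cong; sym; trans; subst; module ≡-Reasoning)

\\-suc : ∀ b k → b + 6 * suc k ≡ 6 + (b + 6 * k)
\\-suc = solve-∀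

inc≤1 : ∀ x c → inc x c ≤ 1
inc≤1 q a = z≤n
inc≤1 q d = ≤-refl
inc≤1 s a = ≤-refl
inc≤1 s d = z≤n

δ-inflationary : ∀ ψ m c → m ≤ δ ψ m c
δ-inflationary ψ m c with at ψ m
... | none   = ≤-refl
... | some x = m≤m+n m (inc x c)

δ≤suc : ∀ ψ m c → δ ψ m c ≤ suc m
δ≤suc ψ m c with at ψ m
... | none   = n≤1+n m
... | some x = ≤-trans (+-monoʳ-≤ m (inc≤1 x c)) (≤-reflexive (+-comm m 1))

δ-mono : ∀ ψ c {m m′} → m ≤ m′ → δ ψ m c ≤ δ ψ m′ c
δ-mono ψ c {m} {m′} m≤m′ with m≤n⇒m<n∨m≡n m≤m′
... | inj₁ m<m′ = ≤-trans (δ≤suc ψ m c) (≤-trans m<m′ (δ-inflationary ψ m′ c))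
... | inj₂ refl = ≤-refl

f-inflationary : ∀ ψ m W → m ≤ f ψ m W
f-inflationary ψ m []      = ≤-refl
f-inflationary ψ m (c ∷ W) = ≤-trans (δ-inflationary ψ m c) (f-inflationary ψ (δ ψ m c) W)

f-mono : ∀ ψ W {m m′} → m ≤ m′ → f ψ m W ≤ f ψ m′ W
f-mono ψ []      m≤m′ = m≤m′
f-mono ψ (c ∷ W) m≤m′ = f-mono ψ W (δ-mono ψ c m≤m′)

f-[] : ∀ m W → f [] m W ≡ m
f-[] m []      = refl
f-[] m (c ∷ W) = f-[] m W

δ-∷ : ∀ x ψ m c → δ (x ∷ ψ) (suc m) c ≡ suc (δ ψ m c)
δ-∷ x ψ m c with at ψ m
... | none   = refl
... | some y = refl

f-∷ : ∀ x ψ m W → f (x ∷ ψ) (suc m) W ≡ suc (f ψ m W)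
f-∷ x ψ m []      = refl
f-∷ x ψ m (c ∷ W) rewrite δ-∷ x ψ m c = f-∷ x ψ (δ ψ m c) W

f-++ : ∀ φ ψ m W → f (φ ++ ψ) (length φ + m) W ≡ length φ + f ψ m W
f-++ []      ψ m W = refl
f-++ (x ∷ φ) ψ m W = trans (f-∷ x (φ ++ ψ) (length φ + m) W) (cong suc (f-++ φ ψ m W))

f-block-++ : ∀ x ψ m W → f (block x ++ ψ) (6 + m) W ≡ 6 + f ψ m W
f-block-++ q = f-++ (block q)
f-block-++ s = f-++ (block s)

f-ψ̈\\ : ∀ A k b W → f (ψ̈\\ A) (b \\ k) W ≡ f (ψ̈\\ (drop k A)) b W \\ k
f-ψ̈\\ A zero b W rewrite +-identityʳ b = sym (+-identityʳ _)
f-ψ̈\\ [] (suc k) b W = trans (f-[] (b \\ suc k) W) (cong (_\\ suc k) (sym (f-[] b W)))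
f-ψ̈\\ (x ∷ A) (suc k) b W = begin
  f (block x ++ ψ̈\\ A) (b \\ suc k) W  ≡⟨ cong (λ m → f (block x ++ ψ̈\\ A) m W) (\\-suc b k) ⟩
  f (block x ++ ψ̈\\ A) (6 + b \\ k) W  ≡⟨ f-block-++ x (ψ̈\\ A) (b \\ k) W ⟩
  6 + f (ψ̈\\ A) (b \\ k) W             ≡⟨ cong (6 +_) (f-ψ̈\\ A k b W) ⟩
  6 + f (ψ̈\\ B) b W \\ k               ≡⟨ sym (\\-suc (f (ψ̈\\ B) b W) k) ⟩
  f (ψ̈\\ B) b W \\ suc k               ∎
  where
  open ≡-Reasoning
  B = drop k A

f-ψ̈\\-0-daaaadda : ∀ A → 0 < length A → f (ψ̈\\ A) 0 daaaadda ≡ 3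
f-ψ̈\\-0-daaaadda (q ∷ A) _ = refl
f-ψ̈\\-0-daaaadda (s ∷ A) _ = refl

-- In block qqssss the prefix daaaa already leads from 1 to 6.
f-ψ̈\\-1-daaaadda : ∀ A → 0 < length A → 5 ≤ f (ψ̈\\ A) 1 daaaadda
f-ψ̈\\-1-daaaadda (q ∷ A) _ = ≤-refl
f-ψ̈\\-1-daaaadda (s ∷ A) _ = ≤-trans (n≤1+n 5) (f-inflationary (ψ̈\\ (s ∷ A)) 6 (d ∷ d ∷ a ∷ []))

lemma8 : (n : ℕ) → 1 ≤ n → (A : List QS) → length A ≡ n →
           (k : ℕ) → k < n →
           (f (ψ̈\\ A) (0 \\ k) daaaadda ≡ 3 \\ k)
           × ((k′ : ℕ) → 1 \\ k ≤ k′ → k′ ≤ 6 * n →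
              5 \\ k ≤ f (ψ̈\\ A) k′ daaaadda)
lemma8 n _ A refl k k<n = from-0 , from-above-1
  where
  B = drop k A

  B≢[] : 0 < length B
  B≢[] = subst (0 <_) (sym (length-drop k A)) (m<n⇒0<n∸m k<n)

  from-0 : f (ψ̈\\ A) (0 \\ k) daaaadda ≡ 3 \\ k
  from-0 = trans (f-ψ̈\\ A k 0 daaaadda) (cong (_\\ k) (f-ψ̈\\-0-daaaadda B B≢[]))

  from-above-1 : (k′ : ℕ) → 1 \\ k ≤ k′ → k′ ≤ 6 * n → 5 \\ k ≤ f (ψ̈\\ A) k′ daaaadda
  from-above-1 k′ 1\\k≤k′ _ = begin
    5 \\ k                          ≤⟨ +-monoˡ-≤ (6 * k) (f-ψ̈\\-1-daaaadda B B≢[]) ⟩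
    f (ψ̈\\ B) 1 daaaadda \\ k       ≡⟨ f-ψ̈\\ A k 1 daaaadda ⟨
    f (ψ̈\\ A) (1 \\ k) daaaadda     ≤⟨ f-mono (ψ̈\\ A) daaaadda 1\\k≤k′ ⟩
    f (ψ̈\\ A) k′ daaaadda           ∎
    where open ≤-Reasoning
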